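{- Let $\alpha=(\alpha_1,\dots,\alpha_t)\in\mathcal{P}(n)$ with $\delta(\alpha)=\big(1,2,\dots,q-1,q,q^{(s_q)},(q-1)^{(s_{q-1})},\dots,1^{(s_1)}\big)$, where $q>0$ and $s_1,\dots,s_q\ge0$ are integers. Then $\alpha_1\in A_1=\{q,\ q+s_q,\ q+s_q+s_{q-1},\ \dots,\ q+\sum_{i=1}^q s_i\}$; equivalently, the largest part of $\alpha$ lies in $A_1$.
   Context: $\mathcal{P}(n)$ is the set of partitions $\alpha=(\alpha_1\ge\dots\ge\alpha_t\ge1)$ of $n$, with $\alpha_i=0$ for $i>t$. The diagonal sequence is $\delta(\alpha)=(d_k)_{k\ge1}$ with $d_k=\big|\{i:1\le i\le k,\ \alpha_i+i-1\ge k\}\big|$, trailing zeros omitted. The notation $m^{(s)}$ means $s$ consecutive entries equal to $m$. -}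

module Defs where

open import Data.Nat using (ℕ; zero; suc; _+_; _∸_; _≤_; _≥_; _≤?_; _≟_)
open import Data.List using (List; []; _∷_; _++_; length; filter; map; upTo; replicate; reverse)
open import Data.Nat.ListAction using (sum)
open import Relation.Binary.PropositionalEquality using (_≡_)
open import Data.List.Relation.Unary.All using (All)
open import Data.List.Relation.Unary.Linked using (Linked)
open import Data.Product using (_×_; Σ)
open import Relation.Nullary using (yes; no)

IsPartition : ℕ → List ℕ → Set
IsPartition n α = Linked _≥_ α × All (λ a → 1 ≤ a) α × sum α ≡ n

-- α_i (1-indexed), with α_i = 0 beyond the length (and α_0 := 0, unused).
part : List ℕ → ℕ → ℕ
part []      _             = 0
part (a ∷ α) zero          = 0
part (a ∷ α) (suc zero)    = a
part (a ∷ α) (suc (suc i)) = part α (suc i)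

α₁ : List ℕ → ℕ
α₁ α = part α 1

oneTo : ℕ → List ℕ
oneTo k = map suc (upTo k)

dk : List ℕ → ℕ → ℕ
dk α k = length (filter (λ i → k ≤? part α i + i ∸ 1) (oneTo k))

dropLeadingZeros : List ℕ → List ℕ
dropLeadingZeros []          = []
dropLeadingZeros (zero ∷ xs) = dropLeadingZeros xs
dropLeadingZeros (x ∷ xs)    = x ∷ xs

dropTrailingZeros : List ℕ → List ℕ
dropTrailingZeros xs = reverse (dropLeadingZeros (reverse xs))

-- δ(α) = (d_1, d_2, ...) with trailing zeros omitted.  For a partition of n,
-- d_k = 0 for all k > n (indeed α_i + i - 1 ≤ n), so it suffices to list d_1..d_n;
-- here n = sum α.
δ : List ℕ → List ℕ
δ α = dropTrailingZeros (map (dk α) (oneTo (sum α)))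

-- q^(s_q), (q-1)^(s_{q-1}), ..., 1^(s_1)   (s j is s_j; only j = 1..q used)
blocks : (ℕ → ℕ) → ℕ → List ℕ
blocks s zero    = []
blocks s (suc j) = replicate (s (suc j)) (suc j) ++ blocks s j

targetSeq : ℕ → (ℕ → ℕ) → List ℕ
targetSeq q s = oneTo q ++ blocks s q

-- Σ_{i = m+1}^{q} s_i
sumRange : (ℕ → ℕ) → ℕ → ℕ → ℕ
sumRange s m q = sum (map (λ k → s (suc (m + k))) (upTo (q ∸ m)))

-- x ∈ A_1 = { q, q + s_q, q + s_q + s_{q-1}, ..., q + Σ_{i=1}^q s_i }
-- i.e. x = q + Σ_{i=m+1}^{q} s_i for some 0 ≤ m ≤ q.
InA₁ : ℕ → (ℕ → ℕ) → ℕ → Set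
InA₁ q s x = Σ ℕ (λ m → m ≤ q × x ≡ q + sumRange s m q)

module Submission where

open import Defs
open import Data.Nat using (ℕ; zero; suc; _+_; _∸_; _≤_; _<_; _≥_; _≤?_; _≟_; z≤n; s≤s; z<s)
open import Data.Nat.Properties
open import Data.Nat.ListAction using (sum)
open import Data.Nat.ListAction.Properties using (sum-++)
open import Data.List using (List; []; _∷_; [_]; _++_; length; filter; map; upTo; applyUpTo; replicate; reverse)
open import Data.List.Properties
  using (map-∘; map-upTo; length-map; length-upTo; length-replicate; upTo-∷ʳ; map-++;
         unfold-reverse; reverse-++; reverse-involutive; length-++;
         filter-accept; filter-reject; filter-++; length-filter; filter-all; filter-notAll)
open import Data.List.Relation.Unary.All as All using (All; []; _∷_)
open import Data.List.Relation.Unary.All.Properties using (++⁺; replicate⁺; ¬All⇒Any¬)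
open import Data.List.Relation.Unary.Any using (Any; here; there)
open import Data.List.Relation.Unary.Linked using (Linked; []; [-]; _∷_)
open import Data.List.Membership.Propositional using (_∈_; find; lose)
open import Data.List.Membership.Propositional.Properties
  using (∈-length; ∈-map⁺; ∈-map⁻; ∈-upTo⁺; ∈-upTo⁻; ∈-filter⁺)
open import Data.Product using (∃; _×_; _,_; proj₂)
open import Data.Sum using ([_,_]′)
open import Relation.Binary.PropositionalEquality
  using (_≡_; _≢_; refl; sym; trans; cong; subst; subst₂; module ≡-Reasoning)
open import Relation.Binary.Definitions using (tri<; tri≈; tri>)
open import Function using (_∘_)
open import Relation.Unary using (Decidable)
open import Relation.Nullary using (¬_; yes; no; contradiction)

-- Write F i = α_i + i − 1, so that d_k counts the i ≤ k with k ≤ F i; as α is weakly decreasing,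
-- F rises by at most one per step.  Since d_q = q, every i ≤ q has F i ≥ q, in particular α_1 = F 1 ≥ q,
-- and α_1 = q lies in A_1.  Otherwise d_{q+1} ≤ q yields an i₀ ≤ q + 1 with F i₀ ≤ q < α_1, and the
-- diagonal sequence strictly drops at a = α_1: from d_a to d_{a+1} every i with F i = a is lost, i = 1
-- among them, while only i = a + 1 can be gained; and if it is, F climbs from F i₀ < a past a by unit
-- steps, so it takes the value a at a second index.  In the sequence (1, …, q, q^(s_q), …, 1^(s_1)) the
-- strict drops after position q happen exactly at the positions q + s_q + ⋯ + s_{m+1}, the elements of A_1.

part-beyond : ∀ xs {k} → length xs < k → part xs k ≡ 0
part-beyond []       _                      = refl
part-beyond (x ∷ xs) {suc (suc k)} (s≤s lt) = part-beyond xs lt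

part-++ˡ : ∀ xs ys {j} → j < length xs → part (xs ++ ys) (suc j) ≡ part xs (suc j)
part-++ˡ (x ∷ xs) ys {zero}  _        = refl
part-++ˡ (x ∷ xs) ys {suc j} (s≤s lt) = part-++ˡ xs ys lt

part-++ʳ : ∀ xs ys j → part (xs ++ ys) (suc (length xs + j)) ≡ part ys (suc j)
part-++ʳ []       ys j = refl
part-++ʳ (x ∷ xs) ys j = part-++ʳ xs ys j

descent-++ʳ : ∀ xs ys {l} → length xs ≡ l → ∀ j →
  part (xs ++ ys) (suc (suc (l + j))) < part (xs ++ ys) (suc (l + j)) → part ys (suc (suc j)) < part ys (suc j)
descent-++ʳ xs ys refl j =
  subst₂ _<_ (trans (cong (λ i → part (xs ++ ys) (suc i)) (sym (+-suc (length xs) j))) (part-++ʳ xs ys (suc j)))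
             (part-++ʳ xs ys j)

part-applyUpTo : ∀ (f : ℕ → ℕ) {n j} → j < n → part (applyUpTo f n) (suc j) ≡ f j
part-applyUpTo f {suc n} {zero}  _        = refl
part-applyUpTo f {suc n} {suc j} (s≤s lt) = part-applyUpTo (f ∘ suc) lt

part-map-upTo : ∀ (f : ℕ → ℕ) {n j} → j < n → part (map f (upTo n)) (suc j) ≡ f j
part-map-upTo f {n} lt = trans (cong (λ xs → part xs _) (map-upTo f n)) (part-applyUpTo f lt)

part-map-oneTo : ∀ (f : ℕ → ℕ) {n j} → j < n → part (map f (oneTo n)) (suc j) ≡ f (suc j)
part-map-oneTo f {n} lt = trans (cong (λ xs → part xs _) (sym (map-∘ (upTo n)))) (part-map-upTo (f ∘ suc) lt)

part-All-≤ : ∀ {p} xs k → All (_≤ p) xs → part xs k ≤ p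
part-All-≤ []       k             _          = z≤n
part-All-≤ (x ∷ xs) zero          _          = z≤n
part-All-≤ (x ∷ xs) (suc zero)    (x≤p ∷ _)  = x≤p
part-All-≤ (x ∷ xs) (suc (suc k)) (_ ∷ xs≤p) = part-All-≤ xs (suc k) xs≤p

part-++-zeros : ∀ xs {zs} k → All (_≡ 0) zs → part (xs ++ zs) k ≡ part xs k
part-++-zeros []       k             zs≡0 = part-zeros k zs≡0
  where
  part-zeros : ∀ {zs} k → All (_≡ 0) zs → part zs k ≡ 0
  part-zeros          k             []         = refl
  part-zeros          zero          (_ ∷ _)    = refl
  part-zeros          (suc zero)    (z≡0 ∷ _)  = z≡0
  part-zeros {_ ∷ zs} (suc (suc k)) (_ ∷ zs≡0) = part-zeros (suc k) zs≡0
part-++-zeros (x ∷ xs) zero          _    = refl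
part-++-zeros (x ∷ xs) (suc zero)    _    = refl
part-++-zeros (x ∷ xs) (suc (suc k)) zs≡0 = part-++-zeros xs (suc k) zs≡0

length-oneTo : ∀ n → length (oneTo n) ≡ n
length-oneTo n = trans (length-map suc (upTo n)) (length-upTo n)

length-map-oneTo : ∀ (f : ℕ → ℕ) n → length (map f (oneTo n)) ≡ n
length-map-oneTo f n = trans (length-map f (oneTo n)) (length-oneTo n)

oneTo-suc : ∀ k → oneTo (suc k) ≡ oneTo k ++ [ suc k ]
oneTo-suc k = trans (cong (map suc) (sym (upTo-∷ʳ k))) (map-++ suc (upTo k) [ k ])

∈-oneTo⁺ : ∀ {i k} → 1 ≤ i → i ≤ k → i ∈ oneTo k
∈-oneTo⁺ {suc i} _ i≤k = ∈-map⁺ suc (∈-upTo⁺ i≤k)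

∈-oneTo⁻ : ∀ {i k} → i ∈ oneTo k → 1 ≤ i × i ≤ k
∈-oneTo⁻ i∈ with ∈-map⁻ suc i∈
... | _ , j∈ , refl = z<s , ∈-upTo⁻ j∈

All-reverse⁺ : ∀ {P : ℕ → Set} {xs} → All P xs → All P (reverse xs)
All-reverse⁺ {xs = []}     []         = []
All-reverse⁺ {xs = x ∷ xs} (px ∷ pxs) rewrite unfold-reverse x xs = ++⁺ (All-reverse⁺ pxs) (px ∷ [])

dropLeadingZeros-split : ∀ xs → ∃ λ zs → All (_≡ 0) zs × xs ≡ zs ++ dropLeadingZeros xs
dropLeadingZeros-split []           = [] , [] , refl
dropLeadingZeros-split (zero ∷ xs)  with zs , zs≡0 , eq ← dropLeadingZeros-split xs =
  0 ∷ zs , refl ∷ zs≡0 , cong (0 ∷_) eq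
dropLeadingZeros-split (suc x ∷ xs) = [] , [] , refl

dropTrailingZeros-split : ∀ xs → ∃ λ zs → All (_≡ 0) zs × xs ≡ dropTrailingZeros xs ++ zs
dropTrailingZeros-split xs with zs , zs≡0 , eq ← dropLeadingZeros-split (reverse xs) =
  reverse zs , All-reverse⁺ zs≡0 , (begin
    xs                                                  ≡⟨ reverse-involutive xs ⟨
    reverse (reverse xs)                                ≡⟨ cong reverse eq ⟩
    reverse (zs ++ dropLeadingZeros (reverse xs))       ≡⟨ reverse-++ zs _ ⟩
    dropTrailingZeros xs ++ reverse zs                  ∎)
  where open ≡-Reasoning

part-dropTrailingZeros : ∀ xs k → part (dropTrailingZeros xs) k ≡ part xs k
part-dropTrailingZeros xs k with zs , zs≡0 , eq ← dropTrailingZeros-split xs =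
  trans (sym (part-++-zeros (dropTrailingZeros xs) k zs≡0)) (cong (λ ys → part ys k) (sym eq))

part-δ : ∀ α {k} → 1 ≤ k → k ≤ sum α → part (δ α) k ≡ dk α k
part-δ α {suc j} _ k≤N =
  trans (part-dropTrailingZeros (map (dk α) (oneTo (sum α))) (suc j)) (part-map-oneTo (dk α) k≤N)

part-δ-≤ : ∀ α j → part (δ α) (suc j) ≤ dk α (suc j)
part-δ-≤ α j with suc j ≤? sum α
... | yes k≤N = ≤-reflexive (part-δ α z<s k≤N)
... | no  k≰N = subst (_≤ dk α (suc j)) (sym beyond) z≤n
  where
  D : List ℕ
  D = map (dk α) (oneTo (sum α))
  beyond : part (δ α) (suc j) ≡ 0
  beyond = trans (part-dropTrailingZeros D (suc j))
                 (part-beyond D (subst (_< suc j) (sym (length-map-oneTo (dk α) (sum α))) (≰⇒> k≰N)))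

filter-short⇒Any¬ : ∀ {P : ℕ → Set} (P? : Decidable P) xs →
  length (filter P? xs) < length xs → Any (¬_ ∘ P) xs
filter-short⇒Any¬ P? xs short = ¬All⇒Any¬ P? xs (λ all → <-irrefl (cong length (filter-all P? all)) short)

∈-≢-∈⇒2≤length : ∀ {x y : ℕ} {xs} → x ∈ xs → y ∈ xs → x ≢ y → 2 ≤ length xs
∈-≢-∈⇒2≤length (here refl) (here refl) x≢y = contradiction refl x≢y
∈-≢-∈⇒2≤length (here _)    (there y∈)  _   = s≤s (∈-length y∈)
∈-≢-∈⇒2≤length (there x∈)  _           _   = s≤s (∈-length x∈)

unitStep-intermediate : ∀ (G : ℕ → ℕ) → (∀ i → G (suc i) ≤ suc (G i)) →
  ∀ {k} i d → G i ≤ k → k < G (i + d) → ∃ λ j → i ≤ j × j < i + d × G j ≡ k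
unitStep-intermediate G step i zero    Gi≤k k<G =
  contradiction (subst (λ l → _ < G l) (+-identityʳ i) k<G) (≤⇒≯ Gi≤k)
unitStep-intermediate G step {k} i (suc d) Gi≤k k<G with G i ≟ k
... | yes Gi≡k = i , ≤-refl , m<m+n i z<s , Gi≡k
... | no  Gi≢k with j , 1+i≤j , j<1+i+d , Gj≡k ← unitStep-intermediate G step (suc i) d
                                                   (≤-trans (step i) (≤∧≢⇒< Gi≤k Gi≢k))
                                                   (subst (λ l → k < G l) (+-suc i d) k<G) =
  j , <⇒≤ 1+i≤j , subst (j <_) (sym (+-suc i d)) j<1+i+d , Gj≡k

count≥ : (ℕ → ℕ) → ℕ → List ℕ → ℕ
count≥ F k xs = length (filter (λ i → k ≤? F i) xs)

count≡ : (ℕ → ℕ) → ℕ → List ℕ → ℕ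
count≡ F k xs = length (filter (λ i → F i ≟ k) xs)

count≥-split : ∀ F k xs → count≥ F k xs ≡ count≥ F (suc k) xs + count≡ F k xs
count≥-split F k []       = refl
count≥-split F k (x ∷ xs) with <-cmp (F x) k
... | tri< Fx<k _ _
  rewrite filter-reject (λ i → k ≤? F i) {xs = xs} (<⇒≱ Fx<k)
        | filter-reject (λ i → suc k ≤? F i) {xs = xs} (<⇒≱ (m<n⇒m<1+n Fx<k))
        | filter-reject (λ i → F i ≟ k) {xs = xs} (<⇒≢ Fx<k)
  = count≥-split F k xs
... | tri≈ _ Fx≡k _
  rewrite filter-accept (λ i → k ≤? F i) {xs = xs} (≤-reflexive (sym Fx≡k))
        | filter-reject (λ i → suc k ≤? F i) {xs = xs} (<⇒≱ (≤-reflexive (cong suc Fx≡k)))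
        | filter-accept (λ i → F i ≟ k) {xs = xs} Fx≡k
  = trans (cong suc (count≥-split F k xs)) (sym (+-suc _ _))
... | tri> _ _ k<Fx
  rewrite filter-accept (λ i → k ≤? F i) {xs = xs} (<⇒≤ k<Fx)
        | filter-accept (λ i → suc k ≤? F i) {xs = xs} k<Fx
        | filter-reject (λ i → F i ≟ k) {xs = xs} (>⇒≢ k<Fx)
  = cong suc (count≥-split F k xs)

dkOf : (ℕ → ℕ) → ℕ → ℕ
dkOf F k = count≥ F k (oneTo k)

dkOf-suc : ∀ F k → dkOf F (suc k) ≡ count≥ F (suc k) (oneTo k) + count≥ F (suc k) [ suc k ]
dkOf-suc F k = begin
  length (filter P? (oneTo (suc k)))                          ≡⟨ cong (length ∘ filter P?) (oneTo-suc k) ⟩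
  length (filter P? (oneTo k ++ [ suc k ]))                   ≡⟨ cong length (filter-++ P? (oneTo k) _) ⟩
  length (filter P? (oneTo k) ++ filter P? [ suc k ])         ≡⟨ length-++ (filter P? (oneTo k)) ⟩
  count≥ F (suc k) (oneTo k) + count≥ F (suc k) [ suc k ]     ∎
  where
  open ≡-Reasoning
  P? : Decidable (λ i → suc k ≤ F i)
  P? i = suc k ≤? F i

dkOf<⇒∃ : ∀ F {k} → dkOf F k < k → ∃ λ i → (1 ≤ i × i ≤ k) × F i < k
dkOf<⇒∃ F {k} d<k
  with i , i∈ , k≰Fi ← find (filter-short⇒Any¬ (λ i → k ≤? F i) (oneTo k)
                                                (subst (dkOf F k <_) (sym (length-oneTo k)) d<k)) =
  i , ∈-oneTo⁻ i∈ , ≰⇒> k≰Fi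

≤dkOf⇒≤ : ∀ F {k i} → k ≤ dkOf F k → 1 ≤ i → i ≤ k → k ≤ F i
≤dkOf⇒≤ F {k} {i} k≤d 1≤i i≤k with k ≤? F i
... | yes k≤Fi = k≤Fi
... | no  k≰Fi = contradiction (subst (dkOf F k <_) (length-oneTo k)
                                  (filter-notAll (λ j → k ≤? F j) (oneTo k) (lose (∈-oneTo⁺ 1≤i i≤k) k≰Fi)))
                               (≤⇒≯ k≤d)

dkOf-descent : ∀ F → (∀ i → F (suc (suc i)) ≤ suc (F (suc i))) →
  ∀ {i₀} → 1 ≤ i₀ → i₀ ≤ F 1 → F i₀ < F 1 → dkOf F (suc (F 1)) < dkOf F (F 1)
dkOf-descent F step {suc i} _ 1+i≤a F1+i<a = begin-strict
  dkOf F (suc a)                                                 ≡⟨ dkOf-suc F a ⟩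
  count≥ F (suc a) (oneTo a) + count≥ F (suc a) [ suc a ]        <⟨ +-monoʳ-< _ gained<lost ⟩
  count≥ F (suc a) (oneTo a) + count≡ F a (oneTo a)              ≡⟨ count≥-split F a (oneTo a) ⟨
  dkOf F a                                                       ∎
  where
  open ≤-Reasoning
  a : ℕ
  a = F 1
  1∈ : 1 ∈ filter (λ i → F i ≟ a) (oneTo a)
  1∈ = ∈-filter⁺ (λ i → F i ≟ a) (∈-oneTo⁺ ≤-refl (≤-trans z<s 1+i≤a)) refl
  gained<lost : count≥ F (suc a) [ suc a ] < count≡ F a (oneTo a)
  gained<lost with suc a ≤? F (suc a)
  ... | no  a≮F =
    subst (_< count≡ F a (oneTo a)) (sym (cong length (filter-reject (λ i → suc a ≤? F i) a≮F))) (∈-length 1∈)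
  ... | yes a<F
    with j , i≤j , j<a , Fj≡a ← unitStep-intermediate (F ∘ suc) step i (a ∸ i) (<⇒≤ F1+i<a)
                                   (subst (λ l → a < F (suc l)) (sym (m+[n∸m]≡n (<⇒≤ 1+i≤a))) a<F) =
    <-≤-trans (s≤s (length-filter (λ i → suc a ≤? F i) [ suc a ]))
              (∈-≢-∈⇒2≤length 1∈ (∈-filter⁺ (λ i → F i ≟ a) (∈-oneTo⁺ z<s 1+j≤a) Fj≡a) 1≢1+j)
    where
    1+j≤a : suc j ≤ a
    1+j≤a = subst (suc j ≤_) (m+[n∸m]≡n (<⇒≤ 1+i≤a)) j<a
    1≢1+j : 1 ≢ suc j
    1≢1+j 1≡1+j with refl ← n≤0⇒n≡0 (subst (i ≤_) (sym (suc-injective 1≡1+j)) i≤j) =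
      <-irrefl refl F1+i<a

-- For i ≤ k, row i of α meets the k-th antidiagonal iff k ≤ reach α i; hence dk α is dkOf (reach α).
reach : List ℕ → ℕ → ℕ
reach α i = part α i + i ∸ 1

reach-suc : ∀ α i → reach α (suc i) ≡ part α (suc i) + i
reach-suc α i = +-∸-assoc (part α (suc i)) {suc i} {1} (s≤s z≤n)

reach-1 : ∀ α → reach α 1 ≡ α₁ α
reach-1 α = trans (reach-suc α 0) (+-identityʳ (α₁ α))

part-antitone : ∀ {α} → Linked _≥_ α → ∀ i → part α (suc (suc i)) ≤ part α (suc i)
part-antitone []         _       = z≤n
part-antitone [-]        zero    = z≤n
part-antitone [-]        (suc i) = z≤n
part-antitone (a≥b ∷ _)  zero    = a≥b
part-antitone (_ ∷ desc) (suc i) = part-antitone desc i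

reach-step : ∀ {α} → Linked _≥_ α → ∀ i → reach α (suc (suc i)) ≤ suc (reach α (suc i))
reach-step {α} desc i = begin
  reach α (suc (suc i))           ≡⟨ reach-suc α (suc i) ⟩
  part α (suc (suc i)) + suc i    ≤⟨ +-monoˡ-≤ (suc i) (part-antitone desc i) ⟩
  part α (suc i) + suc i          ≡⟨ +-suc (part α (suc i)) i ⟩
  suc (part α (suc i) + i)        ≡⟨ cong suc (reach-suc α i) ⟨
  suc (reach α (suc i))           ∎
  where open ≤-Reasoning

α₁≤sum : ∀ α → α₁ α ≤ sum α
α₁≤sum []      = z≤n
α₁≤sum (a ∷ α) = m≤m+n a (sum α)

dk-descent-at-α₁ : ∀ {α} → Linked _≥_ α → ∀ {k} → dk α k < k → k ≤ α₁ α →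
                   dk α (suc (α₁ α)) < dk α (α₁ α)
dk-descent-at-α₁ {α} desc {k} d<k k≤a with i₀ , (1≤i₀ , i₀≤k) , Fi₀<k ← dkOf<⇒∃ (reach α) d<k =
  subst (λ a → dk α (suc a) < dk α a) (reach-1 α)
        (dkOf-descent (reach α) (reach-step desc) 1≤i₀ (≤-trans i₀≤k k≤F1) (<-≤-trans Fi₀<k k≤F1))
  where
  k≤F1 : k ≤ reach α 1
  k≤F1 = subst (k ≤_) (sym (reach-1 α)) k≤a

sumRange-self : ∀ s p → sumRange s p p ≡ 0
sumRange-self s p rewrite n∸n≡0 p = refl

sumRange-suc : ∀ s {m p} → m ≤ p → sumRange s m (suc p) ≡ s (suc p) + sumRange s m p
sumRange-suc s {m} {p} m≤p = begin
  sum (map g (upTo (suc p ∸ m)))              ≡⟨ cong (λ r → sum (map g (upTo r))) (+-∸-assoc 1 m≤p) ⟩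
  sum (map g (upTo (suc (p ∸ m))))            ≡⟨ cong (sum ∘ map g) (upTo-∷ʳ (p ∸ m)) ⟨
  sum (map g (upTo (p ∸ m) ++ [ p ∸ m ]))     ≡⟨ cong sum (map-++ g (upTo (p ∸ m)) _) ⟩
  sum (map g (upTo (p ∸ m)) ++ [ g (p ∸ m) ]) ≡⟨ sum-++ (map g (upTo (p ∸ m))) _ ⟩
  sumRange s m p + (g (p ∸ m) + 0)            ≡⟨ cong (sumRange s m p +_) (+-identityʳ _) ⟩
  sumRange s m p + s (suc (m + (p ∸ m)))      ≡⟨ cong (λ x → sumRange s m p + s (suc x)) (m+[n∸m]≡n m≤p) ⟩
  sumRange s m p + s (suc p)                  ≡⟨ +-comm _ (s (suc p)) ⟩
  s (suc p) + sumRange s m p                  ∎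
  where
  open ≡-Reasoning
  g : ℕ → ℕ
  g k = s (suc (m + k))

sumRange-last : ∀ s p → sumRange s p (suc p) ≡ s (suc p)
sumRange-last s p = begin
  sumRange s p (suc p)        ≡⟨ sumRange-suc s ≤-refl ⟩
  s (suc p) + sumRange s p p  ≡⟨ cong (s (suc p) +_) (sumRange-self s p) ⟩
  s (suc p) + 0               ≡⟨ +-identityʳ _ ⟩
  s (suc p)                   ∎
  where open ≡-Reasoning

q∈A₁ : ∀ q s → InA₁ q s q
q∈A₁ q s = q , ≤-refl , sym (trans (cong (q +_) (sumRange-self s q)) (+-identityʳ q))

blocks-≤ : ∀ s p → All (_≤ p) (blocks s p)
blocks-≤ s zero    = []
blocks-≤ s (suc p) = ++⁺ (replicate⁺ (s (suc p)) ≤-refl) (All.map m≤n⇒m≤1+n (blocks-≤ s p))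

targetSeq-≤ : ∀ q s → All (_≤ q) (targetSeq q s)
targetSeq-≤ q s = ++⁺ (All.tabulate (proj₂ ∘ ∈-oneTo⁻)) (blocks-≤ s q)

part-targetSeq-top : ∀ q s → part (targetSeq (suc q) s) (suc q) ≡ suc q
part-targetSeq-top q s =
  trans (part-++ˡ (oneTo (suc q)) (blocks s (suc q)) (subst (q <_) (sym (length-oneTo (suc q))) ≤-refl))
        (part-map-upTo suc ≤-refl)

part-replicate-++ˡ : ∀ {c} v ys {i} → i < c → part (replicate c v ++ ys) (suc i) ≡ v
part-replicate-++ˡ {suc c} v ys {zero}  _        = refl
part-replicate-++ˡ {suc c} v ys {suc i} (s≤s lt) = part-replicate-++ˡ v ys lt

blocks-descent : ∀ s p j → part (blocks s p) (suc (suc j)) < part (blocks s p) (suc j) →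
                 ∃ λ m → m < p × suc j ≡ sumRange s m p
blocks-descent s zero    j ()
blocks-descent s (suc p) j desc with <-cmp (suc j) (s (suc p))
... | tri< 1+j<c _ _ =
  contradiction desc (≤⇒≯ (≤-reflexive (trans (part-replicate-++ˡ (suc p) B (<⇒≤ 1+j<c))
                                              (sym (part-replicate-++ˡ (suc p) B 1+j<c)))))
  where
  B : List ℕ
  B = blocks s p
... | tri≈ _ 1+j≡c _ = p , ≤-refl , trans 1+j≡c (sym (sumRange-last s p))
... | tri> _ _ c<1+j with j′ , refl ← m≤n⇒∃[o]m+o≡n (≤-pred c<1+j)
    with m , m<p , 1+j′≡ ← blocks-descent s p j′
           (descent-++ʳ (replicate (s (suc p)) (suc p)) (blocks s p) (length-replicate (s (suc p))) j′ desc) =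
  m , m≤n⇒m≤1+n m<p , (begin
  suc (s (suc p) + j′)              ≡⟨ +-suc (s (suc p)) j′ ⟨
  s (suc p) + suc j′                ≡⟨ cong (s (suc p) +_) 1+j′≡ ⟩
  s (suc p) + sumRange s m p        ≡⟨ sumRange-suc s (<⇒≤ m<p) ⟨
  sumRange s m (suc p)              ∎)
  where open ≡-Reasoning

targetSeq-descent : ∀ q s {k} → q < k → part (targetSeq q s) (suc k) < part (targetSeq q s) k → InA₁ q s k
targetSeq-descent q s q<k desc with j , refl ← m≤n⇒∃[o]m+o≡n q<k
    with m , m<q , 1+j≡ ← blocks-descent s q j (descent-++ʳ (oneTo q) (blocks s q) (length-oneTo q) j desc) =
  m , <⇒≤ m<q , (begin
  suc (q + j)         ≡⟨ +-suc q j ⟨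
  q + suc j           ≡⟨ cong (q +_) 1+j≡ ⟩
  q + sumRange s m q  ∎)
  where open ≡-Reasoning

proposition2p8 : (n : ℕ) (α : List ℕ) → IsPartition n α →
    (q : ℕ) → 0 < q → (s : ℕ → ℕ) →
    δ α ≡ targetSeq q s →
    InA₁ q s (α₁ α)
proposition2p8 _ α (desc , _ , _) (suc q) _ s δα≡T = [ descent-case , top-case ]′ (m≤n⇒m<n∨m≡n 1+q≤a)
  where
  a : ℕ
  a = α₁ α
  T : List ℕ
  T = targetSeq (suc q) s
  T≤dk : ∀ j → part T (suc j) ≤ dk α (suc j)
  T≤dk j = subst (λ L → part L (suc j) ≤ dk α (suc j)) δα≡T (part-δ-≤ α j)
  T≡dk : ∀ {k} → 1 ≤ k → k ≤ sum α → part T k ≡ dk α k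
  T≡dk 1≤k k≤N = trans (cong (λ L → part L _) (sym δα≡T)) (part-δ α 1≤k k≤N)
  1+q≤a : suc q ≤ a
  1+q≤a = subst (suc q ≤_) (reach-1 α)
                (≤dkOf⇒≤ (reach α) (subst (_≤ dk α (suc q)) (part-targetSeq-top q s) (T≤dk q)) ≤-refl z<s)
  top-case : suc q ≡ a → InA₁ (suc q) s a
  top-case 1+q≡a = subst (InA₁ (suc q) s) 1+q≡a (q∈A₁ (suc q) s)
  descent-case : suc q < a → InA₁ (suc q) s a
  descent-case 1+q<a = targetSeq-descent (suc q) s 1+q<a (begin-strict
    part T (suc a)    ≤⟨ T≤dk a ⟩
    dk α (suc a)      <⟨ dk-descent-at-α₁ desc short 1+q<a ⟩
    dk α a            ≡⟨ T≡dk (≤-trans z<s 1+q≤a) (α₁≤sum α) ⟨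
    part T a          ∎)
    where
    open ≤-Reasoning
    short : dk α (suc (suc q)) < suc (suc q)
    short = s≤s (subst (_≤ suc q) (T≡dk z<s (≤-trans 1+q<a (α₁≤sum α)))
                       (part-All-≤ T (suc (suc q)) (targetSeq-≤ (suc q) s)))
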